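{- Let $G$ be a strongly connected bipartite graph, and let $W$ be the set of all vertices of degree $2$ lying in one of the two colour classes of $G$. If the edge set $N_E(W)$ (all edges incident to a vertex of $W$) contains a cycle, then $G$ is a cycle.
   Context: A bipartite graph $G$ with at least one perfect matching is strongly connected if, for a perfect matching $M$ of $G$, the digraph $D(G,M)$ — obtained by orienting every edge of $M$ from one colour class $V_1$ to the other $V_2$ and every other edge from $V_2$ to $V_1$ — is strongly connected (this does not depend on $M$). -}

module Defs where

open import Data.Nat using (ℕ; zero; suc)
open import Data.Fin using (Fin; zero; suc)
open import Data.Bool using (Bool; true; false; T; if_then_else_)
open import Data.List using (List; map; allFin)
open import Data.Nat.ListAction using (sum)
open import Data.Product using (Σ; ∃; _×_; _,_)
open import Data.Sum using (_⊎_; inj₁; inj₂)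
open import Relation.Nullary using (¬_)
open import Relation.Binary.PropositionalEquality using (_≡_)
open import Relation.Binary.Construct.Closure.ReflexiveTransitive using (Star)
open import Function.Definitions using (Injective)

-- A finite simple bipartite graph with colour classes V₁ = Fin m and
-- V₂ = Fin n; E u v says that u ∈ V₁ and v ∈ V₂ are adjacent.
record BipGraph : Set where
  field
    m n : ℕ
    E   : Fin m → Fin n → Bool
open BipGraph public

Vertex : BipGraph → Set
Vertex G = Fin (m G) ⊎ Fin (n G)

record PerfectMatching (G : BipGraph) : Set where
  field
    to      : Fin (m G) → Fin (n G)
    from    : Fin (n G) → Fin (m G)
    to-from : ∀ v → to (from v) ≡ v
    from-to : ∀ u → from (to u) ≡ u
    inE     : ∀ u → T (E G u (to u))
open PerfectMatching public

data Arc (G : BipGraph) (M : PerfectMatching G) : Vertex G → Vertex G → Set where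
  matchArc : ∀ u v → to M u ≡ v → Arc G M (inj₁ u) (inj₂ v)
  otherArc : ∀ u v → T (E G u v) → ¬ (to M u ≡ v) → Arc G M (inj₂ v) (inj₁ u)

StronglyConnectedDigraph : {V : Set} → (V → V → Set) → Set
StronglyConnectedDigraph {V} R = ∀ (x y : V) → Star R x y

-- G is strongly connected: it has a perfect matching M with D(G,M) strongly connected
-- (by the standing remark this does not depend on the choice of M).
StronglyConnected : BipGraph → Set
StronglyConnected G = Σ (PerfectMatching G) λ M → StronglyConnectedDigraph (Arc G M)

deg₁ : (G : BipGraph) → Fin (m G) → ℕ
deg₁ G u = sum (map (λ v → if E G u v then 1 else 0) (allFin (n G)))

deg₂ : (G : BipGraph) → Fin (n G) → ℕ
deg₂ G v = sum (map (λ u → if E G u v then 1 else 0) (allFin (m G)))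

-- cyclic successor on Fin (suc k)
csuc : ∀ {k} → Fin (suc k) → Fin (suc k)
csuc {zero} zero = zero
csuc {suc k} zero = suc zero
csuc {suc k} (suc i) with csuc {k} i
... | zero = zero
... | suc j = suc (suc j)

-- A cycle of G of length 2(k+2):  a₀ b₀ a₁ b₁ … a_{k+1} b_{k+1} a₀, with aᵢ ∈ V₁,
-- bᵢ ∈ V₂ pairwise distinct; its edges are {aᵢ,bᵢ} and {a_{i+1},bᵢ} (indices mod k+2).
record Cycle (G : BipGraph) : Set where
  field
    k     : ℕ
    a     : Fin (suc (suc k)) → Fin (m G)
    b     : Fin (suc (suc k)) → Fin (n G)
    a-inj : Injective _≡_ _≡_ a
    b-inj : Injective _≡_ _≡_ b
    e₁    : ∀ i → T (E G (a i) (b i))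
    e₂    : ∀ i → T (E G (a (csuc i)) (b i))
open Cycle public

CycleEdge : {G : BipGraph} → Cycle G → Fin (m G) → Fin (n G) → Set
CycleEdge C u v = ∃ λ i → (a C i ≡ u × b C i ≡ v) ⊎ (a C (csuc i) ≡ u × b C i ≡ v)

IsCycleGraph : BipGraph → Set
IsCycleGraph G = Σ (Cycle G) λ C →
  (∀ u → ∃ λ i → a C i ≡ u) × (∀ v → ∃ λ i → b C i ≡ v) ×
  (∀ u v → T (E G u v) → CycleEdge C u v)

data Side : Set where
  side₁ side₂ : Side

-- the edge (u , v) lies in N_E(W), W = set of degree-2 vertices of the chosen colour class
InNE-W : (G : BipGraph) → Side → Fin (m G) → Fin (n G) → Set
InNE-W G side₁ u v = deg₁ G u ≡ 2
InNE-W G side₂ u v = deg₂ G v ≡ 2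

NEContainsCycle : (G : BipGraph) → Side → Set
NEContainsCycle G s = Σ (Cycle G) λ C → ∀ u v → CycleEdge C u v → InNE-W G s u v

{-# OPTIONS --safe #-}
-- Say W lies in V₁ (the other case is dual). Every vertex aᵢ of the cycle C then
-- has degree 2, so its neighbours are exactly its two neighbours on C. Hence M
-- matches the aᵢ into the bᵢ, and, as there are equally many of each, onto them.
-- So no arc of D(G,M) enters the vertex set of C from outside; by strong
-- connectivity C contains every vertex, and every edge, being incident to some
-- aᵢ, is an edge of C.
module Submission where

open import Defs
open import Data.Nat using (ℕ; zero; suc; _+_)
open import Data.Nat.Properties using (+-suc; <-irrefl)
open import Data.Fin using (Fin; zero; suc; punchOut; fromℕ)
open import Data.Fin.Properties using (_≟_; any?; punchOut-injective; injective⇒≤; suc-injective)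
open import Data.Bool using (Bool; true; false; T; if_then_else_)
open import Data.Bool.Properties using (T-≡)
open import Data.List using (map; allFin)
open import Data.List.Properties using (map-tabulate)
open import Data.Nat.ListAction using (sum)
open import Data.Product using (∃; _,_; proj₁; proj₂)
open import Data.Sum using (_⊎_; inj₁; inj₂)
open import Data.Empty using (⊥-elim)
open import Relation.Nullary using (¬_; yes; no; does)
open import Relation.Binary.PropositionalEquality
open import Relation.Binary.Construct.Closure.ReflexiveTransitive using (fold)
open import Function using (id; _∘_; Equivalence)
open import Function.Definitions using (Injective)

count : ∀ {N} → (Fin N → Bool) → ℕ
count f = sum (map (λ v → if f v then 1 else 0) (allFin _))

count-suc : ∀ {N} (f : Fin (suc N) → Bool) →
            count f ≡ (if f zero then 1 else 0) + count (f ∘ suc)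
count-suc f = cong (λ xs → g zero + sum xs)
  (trans (map-tabulate suc g) (sym (map-tabulate id (g ∘ suc))))
  where
  g : Fin _ → ℕ
  g v = if f v then 1 else 0

_without_ : ∀ {N} → (Fin N → Bool) → Fin N → Fin N → Bool
(f without x) v = if does (v ≟ x) then false else f v

count-without : ∀ {N} (f : Fin N → Bool) {x} → T (f x) → count f ≡ suc (count (f without x))
count-without {suc N} f {zero} fx = begin
  count f                                     ≡⟨ count-suc f ⟩
  (if f zero then 1 else 0) + count (f ∘ suc) ≡⟨ cong (λ c → (if c then 1 else 0) + count (f ∘ suc)) (Equivalence.to T-≡ fx) ⟩
  suc (count (f ∘ suc))                       ≡⟨ cong suc (sym (count-suc (f without zero))) ⟩
  suc (count (f without zero))                ∎
  where open ≡-Reasoning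
count-without {suc N} f {suc x} fx = begin
  count f                                     ≡⟨ count-suc f ⟩
  f₀ + count (f ∘ suc)                        ≡⟨ cong (f₀ +_) (count-without (f ∘ suc) fx) ⟩
  f₀ + suc (count ((f ∘ suc) without x))      ≡⟨ +-suc f₀ _ ⟩
  suc (f₀ + count ((f ∘ suc) without x))      ≡⟨ cong suc (sym (count-suc (f without suc x))) ⟩
  suc (count (f without suc x))               ∎
  where
  open ≡-Reasoning
  f₀ = if f zero then 1 else 0

without-keeps : ∀ {N} (f : Fin N → Bool) {x y} → ¬ y ≡ x → T (f y) → T ((f without x) y)
without-keeps f {x} {y} y≢x fy with y ≟ x
... | yes y≡x = ⊥-elim (y≢x y≡x)
... | no _ = fy

three-trues⇒count≡3+ : ∀ {N} (f : Fin N → Bool) {x y z} → T (f x) → T (f y) → T (f z) →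
                       ¬ x ≡ y → ¬ z ≡ x → ¬ z ≡ y → ∃ λ c → count f ≡ 3 + c
three-trues⇒count≡3+ f {x} {y} {z} fx fy fz x≢y z≢x z≢y = _ ,
  trans (count-without f fx) (cong suc
  (trans (count-without f₁ (without-keeps f (x≢y ∘ sym) fy)) (cong suc
  (count-without f₂ {z} (without-keeps f₁ z≢y (without-keeps f z≢x fz))))))
  where
  f₁ = f without x
  f₂ = f₁ without y

count≡2⇒≡⊎≡ : ∀ {N} (f : Fin N → Bool) → count f ≡ 2 → ∀ {x y z} →
              T (f x) → T (f y) → ¬ x ≡ y → T (f z) → z ≡ x ⊎ z ≡ y
count≡2⇒≡⊎≡ f count≡2 {x} {y} {z} fx fy x≢y fz with z ≟ x | z ≟ y
... | yes z≡x | _ = inj₁ z≡x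
... | no _ | yes z≡y = inj₂ z≡y
... | no z≢x | no z≢y with c , count≡3+c ← three-trues⇒count≡3+ f fx fy fz x≢y z≢x z≢y
  with () ← trans (sym count≡2) count≡3+c

injective⇒surjective : ∀ {N} {f : Fin N → Fin N} → Injective _≡_ _≡_ f → ∀ t → ∃ λ j → f j ≡ t
injective⇒surjective {suc N} {f} f-inj t with any? (λ j → f j ≟ t)
... | yes hit = hit
... | no miss = ⊥-elim (<-irrefl refl (injective⇒≤ g-inj))
  where
  t≢f : ∀ j → ¬ t ≡ f j
  t≢f j t≡fj = miss (j , sym t≡fj)
  g : Fin (suc N) → Fin N
  g j = punchOut (t≢f j)
  g-inj : Injective _≡_ _≡_ g
  g-inj {i} {j} gi≡gj = f-inj (punchOut-injective (t≢f i) (t≢f j) gi≡gj)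

module _ {A B : Set} (f : A → B) (g : B → A) (g∘f≗id : g ∘ f ≗ id) where

  into⇒onto : ∀ {K} {a : Fin K → A} {b : Fin K → B} → Injective _≡_ _≡_ a →
              (∀ i → ∃ λ j → f (a i) ≡ b j) → ∀ j → ∃ λ i → g (b j) ≡ a i
  into⇒onto {a = a} {b} a-inj into j =
    let i , σi≡j = injective⇒surjective σ-inj j in i , trans (cong (g ∘ b) (sym σi≡j)) (g-b-σ i)
    where
    σ = proj₁ ∘ into
    g-b-σ : ∀ i → g (b (σ i)) ≡ a i
    g-b-σ i = trans (cong g (sym (proj₂ (into i)))) (g∘f≗id (a i))
    σ-inj : Injective _≡_ _≡_ σ
    σ-inj {i} {k} σi≡σk = a-inj (trans (sym (g-b-σ i)) (trans (cong (g ∘ b) σi≡σk) (g-b-σ k)))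

module _ {V : Set} {R : V → V → Set} (sc : StronglyConnectedDigraph R) {P : V → Set} where

  out-closed⇒universal : (∀ {x y} → R x y → P x → P y) → ∀ {x₀} → P x₀ → ∀ x → P x
  out-closed⇒universal step p x = fold (λ x y → P x → P y) (λ r k → k ∘ step r) id (sc _ x) p

  in-closed⇒universal : (∀ {x y} → R x y → P y → P x) → ∀ {x₀} → P x₀ → ∀ x → P x
  in-closed⇒universal step p x = fold (λ x y → P y → P x) (λ r k → step r ∘ k) id (sc x _) p

csuc-fromℕ : ∀ k → csuc (fromℕ k) ≡ zero
csuc-fromℕ zero = refl
csuc-fromℕ (suc k) rewrite csuc-fromℕ k = refl

csuc-suc : ∀ {k} {j : Fin (suc k)} {i} → csuc j ≡ suc i → csuc (suc j) ≡ suc (suc i)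
csuc-suc csuc-j≡suc-i rewrite csuc-j≡suc-i = refl

csuc-surjective : ∀ {k} (i : Fin (suc k)) → ∃ λ j → csuc j ≡ i
csuc-surjective {k} zero = fromℕ k , csuc-fromℕ k
csuc-surjective {suc k} (suc zero) = zero , refl
csuc-surjective {suc k} (suc (suc i)) =
  let j , csuc-j≡suc-i = csuc-surjective {k} (suc i) in suc j , csuc-suc csuc-j≡suc-i

csuc-i≢i : ∀ {k} (i : Fin (suc (suc k))) → ¬ csuc i ≡ i
csuc-i≢i zero ()
csuc-i≢i {zero} (suc zero) ()
csuc-i≢i {suc k} (suc i) with csuc {suc k} i in eq
... | zero = λ ()
... | suc j = λ suc-j≡i → csuc-i≢i i (trans eq (suc-injective suc-j≡i))

module _ {G : BipGraph} (C : Cycle G) where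

  OnCycle : Vertex G → Set
  OnCycle (inj₁ u) = ∃ λ i → a C i ≡ u
  OnCycle (inj₂ v) = ∃ λ i → b C i ≡ v

  CycleEdge⇒OnCycleˡ : ∀ {u v} → CycleEdge C u v → OnCycle (inj₁ u)
  CycleEdge⇒OnCycleˡ (i , inj₁ (aᵢ≡u , _)) = i , aᵢ≡u
  CycleEdge⇒OnCycleˡ (i , inj₂ (aᵢ₊₁≡u , _)) = csuc i , aᵢ₊₁≡u

  CycleEdge⇒OnCycleʳ : ∀ {u v} → CycleEdge C u v → OnCycle (inj₂ v)
  CycleEdge⇒OnCycleʳ (i , inj₁ (_ , bᵢ≡v)) = i , bᵢ≡v
  CycleEdge⇒OnCycleʳ (i , inj₂ (_ , bᵢ≡v)) = i , bᵢ≡v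

  a-neighbours : ∀ {j v} → deg₁ G (a C (csuc j)) ≡ 2 → T (E G (a C (csuc j)) v) →
                 v ≡ b C (csuc j) ⊎ v ≡ b C j
  a-neighbours {j} deg≡2 =
    count≡2⇒≡⊎≡ (E G (a C (csuc j))) deg≡2 (e₁ C (csuc j)) (e₂ C j) (csuc-i≢i j ∘ b-inj C)

  b-neighbours : ∀ {i u} → deg₂ G (b C i) ≡ 2 → T (E G u (b C i)) →
                 u ≡ a C i ⊎ u ≡ a C (csuc i)
  b-neighbours {i} deg≡2 =
    count≡2⇒≡⊎≡ (λ u → E G u (b C i)) deg≡2 (e₁ C i) (e₂ C i) (csuc-i≢i i ∘ sym ∘ a-inj C)

  edge-at-a : ∀ {i v} → deg₁ G (a C i) ≡ 2 → T (E G (a C i) v) → CycleEdge C (a C i) v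
  edge-at-a {i} deg≡2 e with j , refl ← csuc-surjective i with a-neighbours {j} deg≡2 e
  ... | inj₁ refl = csuc j , inj₁ (refl , refl)
  ... | inj₂ refl = j , inj₂ (refl , refl)

  edge-at-b : ∀ {i u} → deg₂ G (b C i) ≡ 2 → T (E G u (b C i)) → CycleEdge C u (b C i)
  edge-at-b {i} deg≡2 e with b-neighbours deg≡2 e
  ... | inj₁ refl = i , inj₁ (refl , refl)
  ... | inj₂ refl = i , inj₂ (refl , refl)

module _ {G : BipGraph} (M : PerfectMatching G) (C : Cycle G) where

  module V₁-side (deg≡2 : ∀ i → deg₁ G (a C i) ≡ 2) where

    a-matched-into-b : ∀ i → ∃ λ j → to M (a C i) ≡ b C j
    a-matched-into-b i =
      let j , bⱼ≡to-aᵢ = CycleEdge⇒OnCycleʳ C (edge-at-a C (deg≡2 i) (inE M (a C i))) in j , sym bⱼ≡to-aᵢ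

    b-matched-into-a : ∀ j → ∃ λ i → from M (b C j) ≡ a C i
    b-matched-into-a = into⇒onto (to M) (from M) (from-to M) (a-inj C) a-matched-into-b

    OnCycle-in-closed : ∀ {x y} → Arc G M x y → OnCycle C y → OnCycle C x
    OnCycle-in-closed (matchArc u _ to-u≡bⱼ) (j , refl) =
      let i , from-bⱼ≡aᵢ = b-matched-into-a j in
      i , trans (sym from-bⱼ≡aᵢ) (trans (cong (from M) (sym to-u≡bⱼ)) (from-to M u))
    OnCycle-in-closed (otherArc _ _ e _) (i , refl) = CycleEdge⇒OnCycleʳ C (edge-at-a C (deg≡2 i) e)

  module V₂-side (deg≡2 : ∀ j → deg₂ G (b C j) ≡ 2) where

    b-matched-into-a : ∀ j → ∃ λ i → from M (b C j) ≡ a C i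
    b-matched-into-a j =
      let i , aᵢ≡from-bⱼ = CycleEdge⇒OnCycleˡ C (edge-at-b C (deg≡2 j) from-bⱼ-bⱼ) in i , sym aᵢ≡from-bⱼ
      where
      from-bⱼ-bⱼ : T (E G (from M (b C j)) (b C j))
      from-bⱼ-bⱼ = subst (T ∘ E G (from M (b C j))) (to-from M (b C j)) (inE M (from M (b C j)))

    a-matched-into-b : ∀ i → ∃ λ j → to M (a C i) ≡ b C j
    a-matched-into-b = into⇒onto (from M) (to M) (to-from M) (b-inj C) b-matched-into-a

    OnCycle-out-closed : ∀ {x y} → Arc G M x y → OnCycle C x → OnCycle C y
    OnCycle-out-closed (matchArc _ _ to-aᵢ≡v) (i , refl) =
      let j , to-aᵢ≡bⱼ = a-matched-into-b i in j , trans (sym to-aᵢ≡bⱼ) to-aᵢ≡v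
    OnCycle-out-closed (otherArc _ _ e _) (j , refl) = CycleEdge⇒OnCycleˡ C (edge-at-b C (deg≡2 j) e)

lemma26 : (G : BipGraph) → StronglyConnected G → (s : Side) → NEContainsCycle G s → IsCycleGraph G
lemma26 G (M , sc) side₁ (C , inW) = C , on-C ∘ inj₁ , on-C ∘ inj₂ , edges
  where
  deg≡2 : ∀ i → deg₁ G (a C i) ≡ 2
  deg≡2 i = inW _ _ (i , inj₁ (refl , refl))
  on-C : ∀ x → OnCycle C x
  on-C = in-closed⇒universal sc (V₁-side.OnCycle-in-closed M C deg≡2) {inj₁ (a C zero)} (zero , refl)
  edges : ∀ u v → T (E G u v) → CycleEdge C u v
  edges u v e with i , refl ← on-C (inj₁ u) = edge-at-a C (deg≡2 i) e
lemma26 G (M , sc) side₂ (C , inW) = C , on-C ∘ inj₁ , on-C ∘ inj₂ , edges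
  where
  deg≡2 : ∀ j → deg₂ G (b C j) ≡ 2
  deg≡2 j = inW _ _ (j , inj₁ (refl , refl))
  on-C : ∀ x → OnCycle C x
  on-C = out-closed⇒universal sc (V₂-side.OnCycle-out-closed M C deg≡2) {inj₂ (b C zero)} (zero , refl)
  edges : ∀ u v → T (E G u v) → CycleEdge C u v
  edges u v e with j , refl ← on-C (inj₂ v) = edge-at-b C (deg≡2 j) e
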